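{- Let $\mathscr{A}=(Q,\Sigma,\delta)$ be a DFA with $n$ states. Suppose there is a letter $b\in\Sigma$ such that $\delta(\cdot,b)$ is a cyclic permutation of $Q$ (a single $n$-cycle), and a letter $a\in\Sigma$ with $|\delta(Q,a)|=n-1$. Let $q_a$ be the state not in $\delta(Q,a)$ and let $q_a^c$ be the unique state with $|\delta^{ -1}(q_a^c,a)|=2$. Let $d\in\{0,1,\ldots,n-1\}$ be the distance on the circle from $q_a$ to $q_a^c$, i.e. $\delta(q_a,b^d)=q_a^c$. If $\gcd(d,n)=1$, then: (1) $\mathscr{A}$ is synchronizing; (2) the shortest synchronizing word of $\mathscr{A}$ has length at most $(n-1)^2$; (3) for every nonempty set $S\subseteq Q$ of size $k$ there exists a word $w_S$ of length at most $n(n-k)$ such that $\delta(Q,w_S)=S$.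
   Context: A DFA is $\mathscr{A}=(Q,\Sigma,\delta)$ with finite state set $Q$, finite alphabet $\Sigma$ and transition function $\delta:Q\times\Sigma\to Q$, extended to words in the usual way and to subsets by $\delta(S,w)=\{\delta(q,w)\mid q\in S\}$; $\delta^{ -1}(q,w)=\{p\in Q\mid\delta(p,w)=q\}$. A word $w$ is synchronizing if $\delta(Q,w)$ is a singleton; $\mathscr{A}$ is synchronizing if such a word exists. -}

module Defs where

open import Data.Nat using (ℕ; zero; suc)
open import Data.Fin using (Fin; _≟_)
open import Data.Fin.Subset using (Subset)
open import Data.Fin.Properties using (any?)
open import Data.List using (List; foldl)
open import Data.Vec using (tabulate)
open import Data.Product using (Σ; ∃; _×_)
open import Relation.Nullary.Decidable using (⌊_⌋)
open import Relation.Binary.PropositionalEquality using (_≡_)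
open import Function.Definitions using (Injective)

Transition : ℕ → ℕ → Set
Transition n m = Fin n → Fin m → Fin n

δ* : ∀ {n m} → Transition n m → Fin n → List (Fin m) → Fin n
δ* δ q w = foldl δ q w

image : ∀ {n m} → Transition n m → List (Fin m) → Subset n
image δ w = tabulate λ q → ⌊ any? (λ p → δ* δ p w ≟ q) ⌋

preimage : ∀ {n m} → Transition n m → Fin n → List (Fin m) → Subset n
preimage δ q w = tabulate λ p → ⌊ δ* δ p w ≟ q ⌋

IsSynchronizingWord : ∀ {n m} → Transition n m → List (Fin m) → Set
IsSynchronizingWord {n} δ w = Σ (Fin n) λ q → ∀ p → δ* δ p w ≡ q

IsSynchronizing : ∀ {n m} → Transition n m → Set
IsSynchronizing δ = ∃ λ w → IsSynchronizingWord δ w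

iter : ∀ {A : Set} → (A → A) → ℕ → A → A
iter f zero x = x
iter f (suc k) x = f (iter f k x)

IsCyclicPermutation : ∀ {n} → (Fin n → Fin n) → Set
IsCyclicPermutation {n} f =
  Injective _≡_ _≡_ f × (∀ p q → ∃ λ (k : ℕ) → iter f k p ≡ q)

-- For a proper nonempty S choose j < n with βʲ qa ∉ S and βʲ qac ∈ S; this is
-- possible because βʲ qac = βᵈ (βʲ qa) and βᵈ has a single orbit (Bézout).  The action
-- σ = βʲ ∘ α of the word a bʲ covers S and is two-to-one over βʲ qac, so its preimage
-- T = σ⁻¹(S) has |T| > |S| (double counting over fibres), and δ(Q,w) = T implies
-- δ(Q, w a bʲ) = S.  Induction on n − |S| gives part (3); applying it to the two
-- a-preimages of qac and appending a gives a reset word of length n (n − 2) + 1 = (n − 1)²,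
-- which is part (2), and part (1) follows.

module Submission where

open import Data.Bool using (Bool; true; false)
open import Data.Bool.Properties using (T-≡)
open import Data.Fin using (Fin; zero; suc; _≟_; toℕ; fromℕ<)
open import Data.Fin.Properties
  using (any?; all?; ¬∀⟶∃¬; pigeonhole; injective⇒≤; toℕ<n; toℕ-fromℕ<; nonZeroIndex)
open import Data.Fin.Subset using (Subset; _∈_; _∉_; _⊆_; ∣_∣; Nonempty; ⊤; _-_)
open import Data.Fin.Subset.Properties
  using (_∈?_; ∈⊤; ⊆-antisym; p⊆q⇒∣p∣≤∣q∣; x∈p⇒∣p-x∣<∣p∣; x∈p∧x≢y⇒x∈p-y;
         ∣⊤∣≡n; ∣⊥∣≡0; nonempty?; Empty-unique; ∣p∣≤n)
open import Data.List using ([]; _∷_; [_]; _++_; replicate; length)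
open import Data.List.Properties using (foldl-++; length-++; length-replicate)
open import Data.Nat
  using (ℕ; zero; suc; _+_; _*_; _∸_; _^_; _≤_; _<_; z≤n; s≤s; s≤s⁻¹; NonZero)
open import Data.Nat.Properties
  using (+-*-semiring; +-comm; +-identityʳ; *-identityʳ; *-assoc; *-suc; ≤-refl; ≤-trans;
         ≤-reflexive; ≤-antisym; <⇒≤; >⇒≢; 1+n≰n; n<1+n; +-mono-≤; +-monoˡ-≤; *-monoʳ-≤;
         m∸n≤m; m<n⇒0<n∸m; m+[n∸m]≡n; m∸n+n≡m; ∸-monoʳ-<; module ≤-Reasoning)
open import Data.Nat.Coprimality using (gcd≡1⇒coprime; coprime-Bézout)
open import Data.Nat.DivMod using (_%_; _/_; m%n<n; m≡m%n+[m/n]*n)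
open import Data.Nat.GCD using (gcd; module Bézout)
open import Data.Product using (∃; _×_; _,_; proj₁; proj₂)
open import Data.Vec using ([]; _∷_; lookup; tabulate)
open import Data.Vec.Properties using (lookup∘tabulate; lookup⇒[]=; []=⇒lookup; tabulate-cong)
open import Function using (_∘_; Equivalence)
open import Function.Definitions using (Injective)
open import Relation.Binary.PropositionalEquality
  using (_≡_; _≢_; refl; sym; trans; cong; cong₂; subst; module ≡-Reasoning)
open import Relation.Nullary using (¬_; Dec; yes; no; contradiction)
open import Relation.Nullary.Decidable using (⌊_⌋; dec-true; isYes≗does; ⌊⌋-map′; toWitness)
open import Relation.Unary using (Decidable)
open import Algebra.Properties.Semiring.Sum +-*-semiring
  using (sum-syntax; sum-cong-≗; sum-replicate-zero; ∑-distrib-+; ∑-comm; *-distribʳ-sum)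

open import Defs

⌊⌋-true⁺ : ∀ {A : Set} (a? : Dec A) → A → ⌊ a? ⌋ ≡ true
⌊⌋-true⁺ a? a = trans (isYes≗does a?) (dec-true a? a)

⌊⌋-true⁻ : ∀ {A : Set} (a? : Dec A) → ⌊ a? ⌋ ≡ true → A
⌊⌋-true⁻ a? e = toWitness (Equivalence.from T-≡ e)

⌊⌋-cong : ∀ {A B : Set} (a? : Dec A) (b? : Dec B) → (A → B) → (B → A) → ⌊ a? ⌋ ≡ ⌊ b? ⌋
⌊⌋-cong (yes _) (yes _) _   _   = refl
⌊⌋-cong (yes a) (no ¬b) A⇒B _   = contradiction (A⇒B a) ¬b
⌊⌋-cong (no ¬a) (yes b) _   B⇒A = contradiction (B⇒A b) ¬a
⌊⌋-cong (no _)  (no _)  _   _   = refl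

∈-tabulate⁺ : ∀ {n} {P : Fin n → Bool} {x} → P x ≡ true → x ∈ tabulate P
∈-tabulate⁺ {P = P} {x} Px = lookup⇒[]= x (tabulate P) (trans (lookup∘tabulate P x) Px)

∈-tabulate⁻ : ∀ {n} {P : Fin n → Bool} {x} → x ∈ tabulate P → P x ≡ true
∈-tabulate⁻ {P = P} {x} x∈ = trans (sym (lookup∘tabulate P x)) ([]=⇒lookup x∈)

_⁻¹[_] : ∀ {n k} → (Fin n → Fin k) → Subset k → Subset n
f ⁻¹[ S ] = tabulate (λ p → lookup S (f p))

⁻¹-∈⁺ : ∀ {n k} (f : Fin n → Fin k) {S p} → f p ∈ S → p ∈ f ⁻¹[ S ]
⁻¹-∈⁺ f fp∈S = ∈-tabulate⁺ ([]=⇒lookup fp∈S)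

⁻¹-∈⁻ : ∀ {n k} (f : Fin n → Fin k) {S p} → p ∈ f ⁻¹[ S ] → f p ∈ S
⁻¹-∈⁻ f {S} {p} p∈ = lookup⇒[]= (f p) S (∈-tabulate⁻ p∈)

module Images {n m : ℕ} (δ : Transition n m) where

  image⁺ : ∀ w p → δ* δ p w ∈ image δ w
  image⁺ w p = ∈-tabulate⁺ (⌊⌋-true⁺ (any? (λ r → δ* δ r w ≟ δ* δ p w)) (p , refl))

  image⁻ : ∀ w {q} → q ∈ image δ w → ∃ λ p → δ* δ p w ≡ q
  image⁻ w {q} q∈ = ⌊⌋-true⁻ (any? (λ p → δ* δ p w ≟ q)) (∈-tabulate⁻ q∈)

  image-≡ : ∀ w (S : Subset n) →
    (∀ {q} → q ∈ S → ∃ λ p → δ* δ p w ≡ q) → (∀ p → δ* δ p w ∈ S) → image δ w ≡ S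
  image-≡ w S reaches stays = ⊆-antisym image⊆S S⊆image
    where
    image⊆S : image δ w ⊆ S
    image⊆S q∈ with image⁻ w q∈
    ... | p , refl = stays p
    S⊆image : S ⊆ image δ w
    S⊆image q∈S with reaches q∈S
    ... | p , refl = image⁺ w p

  image-++ : ∀ w v (g : Fin n → Fin n) (S : Subset n) → (∀ r → δ* δ r v ≡ g r) →
    (∀ {q} → q ∈ S → ∃ λ r → g r ≡ q) → image δ w ≡ g ⁻¹[ S ] → image δ (w ++ v) ≡ S
  image-++ w v g S acts covered reached = image-≡ (w ++ v) S reaches stays
    where
    δ*-++ : ∀ p → δ* δ p (w ++ v) ≡ g (δ* δ p w)
    δ*-++ p = trans (foldl-++ δ p w v) (acts (δ* δ p w))
    reaches : ∀ {q} → q ∈ S → ∃ λ p → δ* δ p (w ++ v) ≡ q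
    reaches q∈S with covered q∈S
    ... | r , refl with image⁻ w (subst (r ∈_) (sym reached) (⁻¹-∈⁺ g q∈S))
    ...   | p , refl = p , δ*-++ p
    stays : ∀ p → δ* δ p (w ++ v) ∈ S
    stays p = subst (_∈ S) (sym (δ*-++ p))
      (⁻¹-∈⁻ g (subst (δ* δ p w ∈_) reached (image⁺ w p)))

  synchronizes : ∀ w v q → image δ w ≡ preimage δ q v → IsSynchronizingWord δ (w ++ v)
  synchronizes w v q reached = q , λ p →
    trans (foldl-++ δ p w v)
      (⌊⌋-true⁻ (δ* δ (δ* δ p w) v ≟ q)
        (∈-tabulate⁻ (subst (δ* δ p w ∈_) reached (image⁺ w p))))

-- Counting points of subsets of Fin n with finite sums.

χ : Bool → ℕ
χ true  = 1
χ false = 0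

∣∣≡∑ : ∀ {n} (S : Subset n) → ∣ S ∣ ≡ ∑[ i < n ] χ (lookup S i)
∣∣≡∑ []          = refl
∣∣≡∑ (true ∷ S)  = cong suc (∣∣≡∑ S)
∣∣≡∑ (false ∷ S) = ∣∣≡∑ S

∣tabulate∣ : ∀ {n} (P : Fin n → Bool) → ∣ tabulate P ∣ ≡ ∑[ i < n ] χ (P i)
∣tabulate∣ P = trans (∣∣≡∑ (tabulate P)) (sum-cong-≗ (cong χ ∘ lookup∘tabulate P))

∑-mono-≤ : ∀ {n} {f g : Fin n → ℕ} → (∀ i → f i ≤ g i) → ∑[ i < n ] f i ≤ ∑[ i < n ] g i
∑-mono-≤ {zero}  _   = z≤n
∑-mono-≤ {suc n} f≤g = +-mono-≤ (f≤g zero) (∑-mono-≤ (f≤g ∘ suc))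

∑-point : ∀ {n} (v : Fin n) (g : Fin n → ℕ) → ∑[ u < n ] (χ ⌊ v ≟ u ⌋ * g u) ≡ g v
∑-point {suc n} zero g = begin
  g zero + 0 + ∑[ u < n ] 0  ≡⟨ cong₂ _+_ (+-identityʳ (g zero)) (sum-replicate-zero n) ⟩
  g zero + 0                 ≡⟨ +-identityʳ (g zero) ⟩
  g zero                     ∎
  where open ≡-Reasoning
∑-point {suc n} (suc v) g = begin
  ∑[ u < n ] (χ ⌊ suc v ≟ suc u ⌋ * g (suc u))
    ≡⟨ sum-cong-≗ (λ u → cong (λ b → χ b * g (suc u)) (⌊⌋-map′ _ _ (v ≟ u))) ⟩
  ∑[ u < n ] (χ ⌊ v ≟ u ⌋ * g (suc u))
    ≡⟨ ∑-point v (g ∘ suc) ⟩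
  g (suc v) ∎
  where open ≡-Reasoning

nonempty-of-size : ∀ {n} (S : Subset n) → 0 < ∣ S ∣ → Nonempty S
nonempty-of-size {n} S 0<∣S∣ with nonempty? S
... | yes ne = ne
... | no empty = contradiction (trans (cong ∣_∣ (Empty-unique empty)) (∣⊥∣≡0 n)) (>⇒≢ 0<∣S∣)

co-singleton : ∀ {n} (P : Subset n) {x} → ∣ P ∣ ≡ n ∸ 1 → x ∉ P → ∀ {u} → u ≢ x → u ∈ P
co-singleton {suc n} P {x} ∣P∣≡n x∉P {u} u≢x with u ∈? P
... | yes u∈P = u∈P
... | no  u∉P = contradiction (subst (λ k → 2 + k ≤ suc n) ∣P∣≡n too-small) (1+n≰n ∘ s≤s⁻¹)
  where
  P⊆ : P ⊆ (⊤ - x) - u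
  P⊆ {y} y∈P = x∈p∧x≢y⇒x∈p-y (x∈p∧x≢y⇒x∈p-y ∈⊤ λ { refl → x∉P y∈P }) λ { refl → u∉P y∈P }
  too-small : 2 + ∣ P ∣ ≤ suc n
  too-small = begin
    2 + ∣ P ∣              ≤⟨ s≤s (s≤s (p⊆q⇒∣p∣≤∣q∣ P⊆)) ⟩
    2 + ∣ (⊤ - x) - u ∣    ≤⟨ s≤s (x∈p⇒∣p-x∣<∣p∣ (x∈p∧x≢y⇒x∈p-y ∈⊤ u≢x)) ⟩
    1 + ∣ ⊤ {suc n} - x ∣  ≤⟨ x∈p⇒∣p-x∣<∣p∣ (∈⊤ {x = x}) ⟩
    ∣ ⊤ {suc n} ∣          ≡⟨ ∣⊤∣≡n (suc n) ⟩
    suc n                  ∎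
    where open ≤-Reasoning

fibre-size : ∀ {n k} → (Fin n → Fin k) → Fin k → ℕ
fibre-size f u = ∣ tabulate (λ p → ⌊ f p ≟ u ⌋) ∣

fibre-size-pos : ∀ {n k} (f : Fin n → Fin k) {p u} → f p ≡ u → 1 ≤ fibre-size f u
fibre-size-pos f {p} {u} fp≡u =
  ≤-trans (s≤s z≤n) (x∈p⇒∣p-x∣<∣p∣ (∈-tabulate⁺ {x = p} (⌊⌋-true⁺ (f p ≟ u) fp≡u)))

fibre-witness : ∀ {n k} (f : Fin n → Fin k) {u} → 1 ≤ fibre-size f u → ∃ λ p → f p ≡ u
fibre-witness f {u} pos with nonempty-of-size _ pos
... | p , p∈ = p , ⌊⌋-true⁻ (f p ≟ u) (∈-tabulate⁻ p∈)

fibre-size-∘ : ∀ {n k l} (g : Fin k → Fin l) (f : Fin n → Fin k) {u} → Injective _≡_ _≡_ g →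
  fibre-size (g ∘ f) (g u) ≡ fibre-size f u
fibre-size-∘ g f {u} g-inj =
  cong ∣_∣ (tabulate-cong λ p → ⌊⌋-cong (g (f p) ≟ g u) (f p ≟ u) g-inj (cong g))

-- Double counting: the preimage of S is the disjoint union of the fibres over S.
∣⁻¹∣≡∑fibres : ∀ {n k} (f : Fin n → Fin k) (S : Subset k) →
  ∣ f ⁻¹[ S ] ∣ ≡ ∑[ u < k ] (fibre-size f u * χ (lookup S u))
∣⁻¹∣≡∑fibres {n} {k} f S = begin
  ∣ f ⁻¹[ S ] ∣
    ≡⟨ ∣tabulate∣ (λ p → lookup S (f p)) ⟩
  ∑[ p < n ] χ (lookup S (f p))
    ≡⟨ sum-cong-≗ (λ p → sym (∑-point (f p) (χ ∘ lookup S))) ⟩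
  ∑[ p < n ] ∑[ u < k ] (χ ⌊ f p ≟ u ⌋ * χ (lookup S u))
    ≡⟨ ∑-comm (λ p u → χ ⌊ f p ≟ u ⌋ * χ (lookup S u)) ⟩
  ∑[ u < k ] ∑[ p < n ] (χ ⌊ f p ≟ u ⌋ * χ (lookup S u))
    ≡⟨ sum-cong-≗ (λ u → sym (*-distribʳ-sum (χ (lookup S u)) (λ p → χ ⌊ f p ≟ u ⌋))) ⟩
  ∑[ u < k ] ((∑[ p < n ] χ ⌊ f p ≟ u ⌋) * χ (lookup S u))
    ≡⟨ sum-cong-≗ (λ u → cong (_* χ (lookup S u)) (sym (∣tabulate∣ (λ p → ⌊ f p ≟ u ⌋)))) ⟩
  ∑[ u < k ] (fibre-size f u * χ (lookup S u)) ∎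
  where open ≡-Reasoning

preimage-grows : ∀ {n k} (f : Fin n → Fin k) (S : Subset k) (c : Fin k) →
  (∀ {u} → u ∈ S → 1 ≤ fibre-size f u) → c ∈ S → 2 ≤ fibre-size f c → ∣ S ∣ < ∣ f ⁻¹[ S ] ∣
preimage-grows {k = k} f S c covered c∈S doubled = begin
  suc ∣ S ∣
    ≡⟨ +-comm 1 ∣ S ∣ ⟩
  ∣ S ∣ + 1
    ≡⟨ cong₂ _+_ (∣∣≡∑ S) (sym (∑-point c (λ _ → 1))) ⟩
  ∑[ u < k ] χ (lookup S u) + ∑[ u < k ] (χ ⌊ c ≟ u ⌋ * 1)
    ≡⟨ ∑-distrib-+ (χ ∘ lookup S) (λ u → χ ⌊ c ≟ u ⌋ * 1) ⟨
  ∑[ u < k ] (χ (lookup S u) + χ ⌊ c ≟ u ⌋ * 1)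
    ≤⟨ ∑-mono-≤ pointwise ⟩
  ∑[ u < k ] (fibre-size f u * χ (lookup S u))
    ≡⟨ ∣⁻¹∣≡∑fibres f S ⟨
  ∣ f ⁻¹[ S ] ∣ ∎
  where
  open ≤-Reasoning
  pointwise : ∀ u → χ (lookup S u) + χ ⌊ c ≟ u ⌋ * 1 ≤ fibre-size f u * χ (lookup S u)
  pointwise u with c ≟ u | lookup S u in u∈?S
  ... | yes refl | true  = ≤-trans doubled (≤-reflexive (sym (*-identityʳ _)))
  ... | yes refl | false = contradiction (trans (sym ([]=⇒lookup c∈S)) u∈?S) λ ()
  ... | no _     | true  =
    ≤-trans (covered (lookup⇒[]= u S u∈?S)) (≤-reflexive (sym (*-identityʳ _)))
  ... | no _     | false = z≤n

module _ {A : Set} (f : A → A) where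

  iter-+ : ∀ k l x → iter f (k + l) x ≡ iter f k (iter f l x)
  iter-+ zero    l x = refl
  iter-+ (suc k) l x = cong f (iter-+ k l x)

  iter-swap : ∀ k l x → iter f k (iter f l x) ≡ iter f l (iter f k x)
  iter-swap k l x = begin
    iter f k (iter f l x) ≡⟨ iter-+ k l x ⟨
    iter f (k + l) x      ≡⟨ cong (λ i → iter f i x) (+-comm k l) ⟩
    iter f (l + k) x      ≡⟨ iter-+ l k x ⟩
    iter f l (iter f k x) ∎
    where open ≡-Reasoning

  iter-* : ∀ d t x → iter (iter f d) t x ≡ iter f (t * d) x
  iter-* d zero    x = refl
  iter-* d (suc t) x = trans (cong (iter f d) (iter-* d t x)) (sym (iter-+ d (t * d) x))

  iter-injective : Injective _≡_ _≡_ f → ∀ k → Injective _≡_ _≡_ (iter f k)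
  iter-injective f-inj zero    e = e
  iter-injective f-inj (suc k) e = iter-injective f-inj k (f-inj e)

  module Periodic (p : ℕ) (f^p≡id : ∀ x → iter f p x ≡ x) where

    iter-*p : ∀ t x → iter f (t * p) x ≡ x
    iter-*p zero    x = refl
    iter-*p (suc t) x = trans (iter-+ p (t * p) x) (trans (cong (iter f p) (iter-*p t x)) (f^p≡id x))

    iter-% : .{{_ : NonZero p}} → ∀ k x → iter f (k % p) x ≡ iter f k x
    iter-% k x = begin
      iter f (k % p) x                           ≡⟨ cong (iter f (k % p)) (iter-*p (k / p) x) ⟨
      iter f (k % p) (iter f ((k / p) * p) x)    ≡⟨ iter-+ (k % p) ((k / p) * p) x ⟨
      iter f (k % p + (k / p) * p) x             ≡⟨ cong (λ i → iter f i x) (m≡m%n+[m/n]*n k p) ⟨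
      iter f k x                                 ∎
      where open ≡-Reasoning

iter-cong : ∀ {A : Set} {f g : A → A} → (∀ x → f x ≡ g x) → ∀ k x → iter f k x ≡ iter g k x
iter-cong f≗g zero    x = refl
iter-cong {g = g} f≗g (suc k) x = trans (f≗g _) (cong g (iter-cong f≗g k x))

δ*-replicate : ∀ {n m} (δ : Transition n m) b j q →
  δ* δ q (replicate j b) ≡ iter (λ x → δ x b) j q
δ*-replicate δ b zero    q = refl
δ*-replicate δ b (suc j) q =
  trans (δ*-replicate δ b j (δ q b)) (iter-swap (λ x → δ x b) j 1 q)

exit-point : ∀ {A : Set} (F : A → A) {P : A → Set} → Decidable P →
  ∀ k x → ¬ P x → P (iter F k x) → ∃ λ z → ¬ P z × P (F z)
exit-point F P? zero    x ¬Px Px   = contradiction Px ¬Px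
exit-point F P? (suc k) x ¬Px PFᵏ⁺¹x with P? (iter F k x)
... | yes PFᵏx = exit-point F P? k x ¬Px PFᵏx
... | no ¬PFᵏx = iter F k x , ¬PFᵏx , PFᵏ⁺¹x

module CyclicPermutation {n : ℕ} (β : Fin n → Fin n) (cyclic : IsCyclicPermutation β) where

  private
    β-injective : Injective _≡_ _≡_ β
    β-injective = proj₁ cyclic

    reaches : ∀ x y → ∃ λ k → iter β k x ≡ y
    reaches = proj₂ cyclic

  -- Pigeonhole on x, βx, …, βⁿx: a positive power of exponent at most n fixes x.
  returns : ∀ x → ∃ λ p → 0 < p × p ≤ n × iter β p x ≡ x
  returns x with pigeonhole (n<1+n n) (λ (i : Fin (suc n)) → iter β (toℕ i) x)
  ... | i , j , i<j , βⁱx≡βʲx =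
    toℕ j ∸ toℕ i , m<n⇒0<n∸m i<j , ≤-trans (m∸n≤m (toℕ j) (toℕ i)) (s≤s⁻¹ (toℕ<n j)) ,
    sym (iter-injective β β-injective (toℕ i) (begin
      iter β (toℕ i) x                           ≡⟨ βⁱx≡βʲx ⟩
      iter β (toℕ j) x                           ≡⟨ cong (λ k → iter β k x) (m+[n∸m]≡n (<⇒≤ i<j)) ⟨
      iter β (toℕ i + (toℕ j ∸ toℕ i)) x         ≡⟨ iter-+ β (toℕ i) (toℕ j ∸ toℕ i) x ⟩
      iter β (toℕ i) (iter β (toℕ j ∸ toℕ i) x)  ∎))
    where open ≡-Reasoning

  -- All points lie in one orbit and powers commute, so a power fixing one point fixes all.
  fixes-all : ∀ p x → iter β p x ≡ x → ∀ y → iter β p y ≡ y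
  fixes-all p x βᵖx≡x y with reaches x y
  ... | k , refl = trans (iter-swap β p k x) (cong (iter β k) βᵖx≡x)

  -- βⁿ is the identity: if β^p = id with 0 < p ≤ n, then the position of a point in the
  -- orbit of y, taken modulo p, is an injection Fin n → Fin p, forcing p = n.
  order : ∀ y → iter β n y ≡ y
  order y with returns y
  ... | suc p-1 , _ , p≤n , βᵖy≡y = subst (λ k → iter β k y ≡ y) (≤-antisym p≤n n≤p) βᵖy≡y
    where
    open Periodic β (suc p-1) (fixes-all (suc p-1) y βᵖy≡y)
    position : Fin n → Fin (suc p-1)
    position q = fromℕ< (m%n<n (proj₁ (reaches y q)) (suc p-1))
    position-correct : ∀ q → iter β (toℕ (position q)) y ≡ q
    position-correct q = trans (cong (λ k → iter β k y) (toℕ-fromℕ< (m%n<n (proj₁ (reaches y q)) (suc p-1))))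
      (trans (iter-% (proj₁ (reaches y q)) y) (proj₂ (reaches y q)))
    n≤p : n ≤ suc p-1
    n≤p = injective⇒≤ {f = position} λ {q} {q′} e → trans (sym (position-correct q))
      (trans (cong (λ i → iter β (toℕ i) y) e) (position-correct q′))

  open Periodic β n order

  orbit-index : ∀ x y → ∃ λ j → j < n × iter β j x ≡ y
  orbit-index x y with reaches x y
  ... | k , βᵏx≡y = k % n , m%n<n k n , trans (iter-% k x) βᵏx≡y
    where instance
      n≢0 : NonZero n
      n≢0 = nonZeroIndex x

  undo : ∀ j → j ≤ n → ∀ y → iter β j (iter β (n ∸ j) y) ≡ y
  undo j j≤n y = trans (sym (iter-+ β j (n ∸ j) y))
    (trans (cong (λ k → iter β k y) (m+[n∸m]≡n j≤n)) (order y))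

  generator : ∀ d → gcd d n ≡ 1 → ∃ λ t → ∀ z → iter (iter β d) t z ≡ β z
  generator d gcd≡1 with coprime-Bézout (gcd≡1⇒coprime gcd≡1)
  ... | Bézout.+- t y 1+yn≡td = t , λ z → begin
    iter (iter β d) t z   ≡⟨ iter-* β d t z ⟩
    iter β (t * d) z      ≡⟨ cong (λ k → iter β k z) 1+yn≡td ⟨
    β (iter β (y * n) z)  ≡⟨ cong β (iter-*p y z) ⟩
    β z                   ∎
    where open ≡-Reasoning
  ... | Bézout.-+ x y 1+xd≡yn = (n ∸ 1) * x , λ z → begin
    iter (iter β d) ((n ∸ 1) * x) z                     ≡⟨ iter-* β d ((n ∸ 1) * x) z ⟩
    iter β ((n ∸ 1) * x * d) z                          ≡⟨ cong (λ k → iter β k z) (*-assoc (n ∸ 1) x d) ⟩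
    iter β ((n ∸ 1) * (x * d)) z                        ≡⟨ cong (iter β ((n ∸ 1) * (x * d))) (wrap z) ⟨
    iter β ((n ∸ 1) * (x * d)) (iter β (n ∸ 1) (β z))   ≡⟨ unwind (n ∸ 1) (β z) ⟩
    β z                                                 ∎
    where
    open ≡-Reasoning
    -- βˣᵈ inverts β, since 1 + xd is a multiple of n.
    inverse : ∀ w → iter β (x * d) (β w) ≡ w
    inverse w = trans (iter-swap β (x * d) 1 w)
      (trans (cong (λ k → iter β k w) 1+xd≡yn) (iter-*p y w))
    unwind : ∀ k w → iter β (k * (x * d)) (iter β k w) ≡ w
    unwind zero    w = refl
    unwind (suc k) w = begin
      iter β (x * d + k * (x * d)) (β (iter β k w))
        ≡⟨ iter-+ β (x * d) (k * (x * d)) _ ⟩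
      iter β (x * d) (iter β (k * (x * d)) (β (iter β k w)))
        ≡⟨ cong (λ v → iter β (x * d) (iter β (k * (x * d)) v)) (iter-swap β 1 k w) ⟩
      iter β (x * d) (iter β (k * (x * d)) (iter β k (β w)))
        ≡⟨ cong (iter β (x * d)) (unwind k (β w)) ⟩
      iter β (x * d) (β w)
        ≡⟨ inverse w ⟩
      w ∎
    wrap : ∀ z → iter β (n ∸ 1) (β z) ≡ z
    wrap z = trans (sym (iter-+ β (n ∸ 1) 1 z))
      (trans (cong (λ k → iter β k z) (m∸n+n≡m (≤-trans (s≤s z≤n) (toℕ<n z)))) (order z))

  coprime-power-reaches : ∀ d → gcd d n ≡ 1 → ∀ x y → ∃ λ k → iter (iter β d) k x ≡ y
  coprime-power-reaches d gcd≡1 x y with generator d gcd≡1 | reaches x y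
  ... | t , βᵈᵗ≡β | k , βᵏx≡y =
    k * t , trans (sym (iter-* (iter β d) t k x)) (trans (iter-cong βᵈᵗ≡β k x) βᵏx≡y)

-- One step of the induction adds at most n letters and lowers the deficiency n − |S|.
step-length : ∀ n {l j s t} → l ≤ n * t → j < n → t < s → l + suc j ≤ n * s
step-length n {l} {j} {s} {t} l≤nt j<n t<s = begin
  l + suc j   ≤⟨ +-mono-≤ l≤nt j<n ⟩
  n * t + n   ≡⟨ +-comm (n * t) n ⟩
  n + n * t   ≡⟨ *-suc n t ⟨
  n * suc t   ≤⟨ *-monoʳ-≤ n t<s ⟩
  n * s       ∎
  where open ≤-Reasoning

square-identity : ∀ {n} → 2 ≤ n → n * (n ∸ 2) + 1 ≡ (n ∸ 1) ^ 2
square-identity {suc (suc k)} (s≤s (s≤s z≤n)) = identity k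
  where
  open import Data.Nat.Tactic.RingSolver using (solve-∀)
  -- (1 + k) ^ 2 unfolds to (1 + k) * ((1 + k) * 1).
  identity : ∀ k → (2 + k) * k + 1 ≡ (1 + k) * ((1 + k) * 1)
  identity = solve-∀

distinct⇒2≤n : ∀ {n} {x y : Fin n} → x ≢ y → 2 ≤ n
distinct⇒2≤n {suc zero}    {zero} {zero} x≢y = contradiction refl x≢y
distinct⇒2≤n {suc (suc n)} _                 = s≤s (s≤s z≤n)

module Proposition2
  {n m : ℕ} (δ : Transition n m) (a b : Fin m)
  (cyclic : IsCyclicPermutation (λ q → δ q b))
  (∣Qa∣≡n-1 : ∣ image δ [ a ] ∣ ≡ n ∸ 1)
  (qa qac : Fin n) (qa∉Qa : qa ∉ image δ [ a ])
  (∣a⁻¹qac∣≡2 : ∣ preimage δ qac [ a ] ∣ ≡ 2)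
  (d : ℕ) (qa↝qac : δ* δ qa (replicate d b) ≡ qac)
  (gcd≡1 : gcd d n ≡ 1) where

  α β : Fin n → Fin n
  α q = δ q a
  β q = δ q b

  open Images δ
  open CyclicPermutation β cyclic

  α-onto : ∀ {u} → u ≢ qa → ∃ λ r → α r ≡ u
  α-onto u≢qa = image⁻ [ a ] (co-singleton (image δ [ a ]) ∣Qa∣≡n-1 qa∉Qa u≢qa)

  -- The a-preimage of qac (definitionally the fibre of α over qac) is nonempty.
  qac-has-preimage : 0 < fibre-size α qac
  qac-has-preimage = ≤-trans (s≤s z≤n) (≤-reflexive (sym ∣a⁻¹qac∣≡2))

  -- qac lies in the image of a, which misses qa.
  qac≢qa : qac ≢ qa
  qac≢qa qac≡qa with fibre-witness α qac-has-preimage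
  ... | r , αr≡qac = qa∉Qa (subst (_∈ image δ [ a ]) (trans αr≡qac qac≡qa) (image⁺ [ a ] r))

  -- If S misses x and contains y, some rotation βʲ with j < n moves qa outside S and qac
  -- inside S: walking from x to y along the single orbit of βᵈ we find z ∉ S with
  -- βᵈ z ∈ S, and take βʲ qa = z, so that βʲ qac = βʲ βᵈ qa = βᵈ z.
  rotation : ∀ (S : Subset n) {x y} → x ∉ S → y ∈ S →
    ∃ λ j → j < n × iter β j qa ∉ S × iter β j qac ∈ S
  rotation S {x} {y} x∉S y∈S with coprime-power-reaches d gcd≡1 x y
  ... | k , walk with exit-point (iter β d) (_∈? S) k x x∉S (subst (_∈ S) (sym walk) y∈S)
  ...   | z , z∉S , βᵈz∈S with orbit-index qa z
  ...     | j , j<n , refl = j , j<n , z∉S , subst (_∈ S) βᵈβʲqa≡βʲqac βᵈz∈S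
    where
    βᵈβʲqa≡βʲqac : iter β d (iter β j qa) ≡ iter β j qac
    βᵈβʲqa≡βʲqac = trans (iter-swap β d j qa)
      (cong (iter β j) (trans (sym (δ*-replicate δ b d qa)) qa↝qac))

  -- If βʲ moves qa outside S and qac inside S, let σ = βʲ ∘ α be the
  -- action of a bʲ.  Then σ covers S (it misses only βʲ qa) and is two-to-one over
  -- βʲ qac, so T = σ⁻¹(S) is larger than S, and reading a bʲ after reaching T reaches S.
  grow : ∀ (S : Subset n) j → j < n → iter β j qa ∉ S → iter β j qac ∈ S →
    ∃ λ T → ∣ S ∣ < ∣ T ∣ × (∀ w → image δ w ≡ T → image δ (w ++ a ∷ replicate j b) ≡ S)
  grow S j j<n βʲqa∉S βʲqac∈S =
    σ ⁻¹[ S ] , larger ,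
    λ w → image-++ w (a ∷ replicate j b) σ S (λ r → δ*-replicate δ b j (α r)) covered
    where
    σ : Fin n → Fin n
    σ r = iter β j (α r)
    avoids-qa : ∀ {q} → q ∈ S → iter β (n ∸ j) q ≢ qa
    avoids-qa {q} q∈S βⁿ⁻ʲq≡qa =
      βʲqa∉S (subst (_∈ S) (trans (sym (undo j (<⇒≤ j<n) q)) (cong (iter β j) βⁿ⁻ʲq≡qa)) q∈S)
    covered : ∀ {q} → q ∈ S → ∃ λ r → σ r ≡ q
    covered {q} q∈S with α-onto (avoids-qa q∈S)
    ... | r , αr≡βⁿ⁻ʲq = r , trans (cong (iter β j) αr≡βⁿ⁻ʲq) (undo j (<⇒≤ j<n) q)
    doubled : 2 ≤ fibre-size σ (iter β j qac)
    doubled = ≤-reflexive (sym (trans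
      (fibre-size-∘ (iter β j) α (iter-injective β (proj₁ cyclic) j)) ∣a⁻¹qac∣≡2))
    larger : ∣ S ∣ < ∣ σ ⁻¹[ S ] ∣
    larger = preimage-grows σ S (iter β j qac)
      (λ u∈S → fibre-size-pos σ (proj₂ (covered u∈S))) βʲqac∈S doubled

  Reachable : Subset n → Set
  Reachable S = ∃ λ w → length w ≤ n * (n ∸ ∣ S ∣) × image δ w ≡ S

  Predecessor : Subset n → Set
  Predecessor S = ∃ λ T → n ∸ ∣ T ∣ < n ∸ ∣ S ∣ × Nonempty T × (Reachable T → Reachable S)

  predecessor : ∀ (S : Subset n) → Nonempty S → ¬ (∀ q → q ∈ S) → Predecessor S
  predecessor S (y , y∈S) ¬all with ¬∀⟶∃¬ n (_∈ S) (_∈? S) ¬all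
  ... | x , x∉S with rotation S x∉S y∈S
  ...   | j , j<n , βʲqa∉S , βʲqac∈S with grow S j j<n βʲqa∉S βʲqac∈S
  ...     | T , S<T , T↝S = T , shrinks , nonempty-of-size T (≤-trans (s≤s z≤n) S<T) , extend
    where
    shrinks : n ∸ ∣ T ∣ < n ∸ ∣ S ∣
    shrinks = ∸-monoʳ-< S<T (∣p∣≤n T)
    extend : Reachable T → Reachable S
    extend (w , w-short , w↝T) =
      w ++ a ∷ replicate j b ,
      ≤-trans (≤-reflexive (trans (length-++ w) (cong (λ k → length w + suc k) (length-replicate j))))
        (step-length n w-short j<n shrinks) ,
      T↝S w w↝T

  reachable-within : ∀ k (S : Subset n) → n ∸ ∣ S ∣ ≤ k → Nonempty S → Reachable S
  reachable-within k S S≤k S≢∅ with all? (_∈? S)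
  ... | yes all∈S = [] , z≤n , image-≡ [] S (λ {q} _ → q , refl) all∈S
  ... | no ¬all = descend k S≤k (predecessor S S≢∅ ¬all)
    where
    descend : ∀ k → n ∸ ∣ S ∣ ≤ k → Predecessor S → Reachable S
    descend zero    S≤0 (_ , shrinks , _) = contradiction (≤-trans shrinks S≤0) λ ()
    descend (suc k) S≤k (T , shrinks , T≢∅ , extend) =
      extend (reachable-within k T (s≤s⁻¹ (≤-trans shrinks S≤k)) T≢∅)

  reachable : ∀ (S : Subset n) → Nonempty S → Reachable S
  reachable S = reachable-within (n ∸ ∣ S ∣) S ≤-refl

  -- Part (2): reach the two a-preimages of qac in n (n − 2) steps, then read a.
  short-synchronizing-word : ∃ λ w → IsSynchronizingWord δ w × length w ≤ (n ∸ 1) ^ 2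
  short-synchronizing-word =
    finish (reachable (preimage δ qac [ a ]) (nonempty-of-size _ qac-has-preimage))
    where
    finish : Reachable (preimage δ qac [ a ]) →
      ∃ λ w → IsSynchronizingWord δ w × length w ≤ (n ∸ 1) ^ 2
    finish (w , w-short , w↝a⁻¹qac) = w ++ [ a ] , synchronizes w [ a ] qac w↝a⁻¹qac , (begin
      length (w ++ [ a ])                      ≡⟨ length-++ w ⟩
      length w + 1                             ≤⟨ +-monoˡ-≤ 1 w-short ⟩
      n * (n ∸ ∣ preimage δ qac [ a ] ∣) + 1   ≡⟨ cong (λ k → n * (n ∸ k) + 1) ∣a⁻¹qac∣≡2 ⟩
      n * (n ∸ 2) + 1                          ≡⟨ square-identity (distinct⇒2≤n qac≢qa) ⟩
      (n ∸ 1) ^ 2                              ∎)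
      where open ≤-Reasoning

proposition2 : ∀ {n m} (δ : Transition n m) (a b : Fin m)
    → IsCyclicPermutation (λ q → δ q b)
    → ∣ image δ [ a ] ∣ ≡ n ∸ 1
    → (qa qac : Fin n)
    → qa ∉ image δ [ a ]
    → ∣ preimage δ qac [ a ] ∣ ≡ 2
    → (d : ℕ) → d < n
    → δ* δ qa (replicate d b) ≡ qac
    → gcd d n ≡ 1
    → IsSynchronizing δ
      × (∃ λ w → IsSynchronizingWord δ w × length w ≤ (n ∸ 1) ^ 2)
      × (∀ (S : Subset n) → Nonempty S
           → ∃ λ w → length w ≤ n * (n ∸ ∣ S ∣) × image δ w ≡ S)
proposition2 δ a b cyclic ∣Qa∣≡n-1 qa qac qa∉Qa ∣a⁻¹qac∣≡2 d _ qa↝qac gcd≡1 =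
  synchronizing , short-synchronizing-word , reachable
  where
  open Proposition2 δ a b cyclic ∣Qa∣≡n-1 qa qac qa∉Qa ∣a⁻¹qac∣≡2 d qa↝qac gcd≡1
  synchronizing : IsSynchronizing δ
  synchronizing = proj₁ short-synchronizing-word , proj₁ (proj₂ short-synchronizing-word)
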